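{- Let $\mathcal{C}$ be a $k$-dimensional $\mathbb{F}_{q^n}$-subspace of $V$. Then $\{x\in\mathbb{F}_{q^n}: g(x)=0\ \text{for all } g\in\mathcal{C}\}=\{0\}$ if and only if $\Omega(\mathcal{C})^{\perp}\cap\Sigma=\emptyset$.
   Context: $V=\mathrm{End}_{\mathbb{F}_q}(\mathbb{F}_{q^n})$ is identified with $\mathbb{F}_{q^n}^n$ by sending the linearised polynomial $f(x)=\sum_{i=0}^{n-1}f_ix^{q^i}$ to its coefficient vector $(f_0,\ldots,f_{n-1})$; $\mathrm{PG}(V)=\mathrm{PG}(n-1,q^n)$. For $\mathcal{C}\subseteq V$, $\Omega(\mathcal{C})=\{\langle f\rangle_{q^n}: f\in\mathcal{C}\setminus\{0\}\}$. $\Sigma=\{(\beta,\beta^q,\ldots,\beta^{q^{n-1}})_{q^n}:\beta\in\mathbb{F}_{q^n}^*\}$ is the set of points of $\mathrm{PG}(n-1,q^n)$ given by maps of rank $1$ (an $\mathbb{F}_q$-subgeometry). The dot product is $f\cdot g=\sum_{i}f_ig_i$, and $\perp$ denotes orthogonal complement (on $V$ and on $\mathrm{PG}(n-1,q^n)$) with respect to it. -}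

module Defs where

open import Level using (Level; _⊔_) renaming (suc to lsuc)
open import Algebra.Bundles using (CommutativeRing)
open import Data.Nat as ℕ using (ℕ; zero; suc)
open import Data.Fin using (Fin; zero; suc; toℕ)
open import Data.Product using (Σ; ∃; _×_; _,_)
open import Data.Nat.Primality using (Prime)
open import Relation.Nullary using (¬_)
open import Relation.Binary.PropositionalEquality using (_≡_)

record Field (c ℓ : Level) : Set (lsuc (c ⊔ ℓ)) where
  field
    commutativeRing : CommutativeRing c ℓ
  open CommutativeRing commutativeRing public
  field
    0≉1     : ¬ (0# ≈ 1#)
    inverse : ∀ x → ¬ (x ≈ 0#) → ∃ λ y → x * y ≈ 1#

IsPrimePower : ℕ → Set
IsPrimePower q = ∃ λ p → ∃ λ e → Prime p × q ≡ p ℕ.^ suc e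

module FieldDefs {c ℓ : Level} (F : Field c ℓ) (q n : ℕ) where
  open Field F using (Carrier; _≈_; _+_; _*_; 0#; 1#)

  pow : Carrier → ℕ → Carrier
  pow x zero    = 1#
  pow x (suc m) = x * pow x m

  sumF : (m : ℕ) → (Fin m → Carrier) → Carrier
  sumF zero    f = 0#
  sumF (suc m) f = f zero + sumF m (λ i → f (suc i))

  -- V = F_{q^n}^n: coefficient vectors (f_0,…,f_{n-1}) of the
  -- linearised polynomials f(x) = Σ f_i x^{q^i}
  Vect : Set c
  Vect = Fin n → Carrier

  eval : Vect → Carrier → Carrier
  eval f x = sumF n (λ i → f i * pow x (q ℕ.^ toℕ i))

  dot : Vect → Vect → Carrier
  dot f g = sumF n (λ i → f i * g i)

  _≈ᵛ_ : Vect → Vect → Set ℓ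
  u ≈ᵛ v = ∀ i → u i ≈ v i

  _·ᵛ_ : Carrier → Vect → Vect
  (a ·ᵛ v) i = a * v i

  NonZeroV : Vect → Set ℓ
  NonZeroV v = ¬ (∀ i → v i ≈ 0#)

  Span : (k : ℕ) → (Fin k → Vect) → Vect → Set (c ⊔ ℓ)
  Span k b v = ∃ λ (a : Fin k → Carrier) → ∀ i → v i ≈ sumF k (λ j → a j * b j i)

  LinIndep : (k : ℕ) → (Fin k → Vect) → Set (c ⊔ ℓ)
  LinIndep k b = ∀ (a : Fin k → Carrier) →
                 (∀ i → sumF k (λ j → a j * b j i) ≈ 0#) → ∀ j → a j ≈ 0#

  -- Point sets of PG(n-1,q^n) are represented by the predicate on nonzero
  -- vectors "v is a representative of a point of the set"
  -- (every such predicate below is closed under nonzero scalar multiples).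

  Ω : (Vect → Set (c ⊔ ℓ)) → Vect → Set (c ⊔ ℓ)
  Ω C v = NonZeroV v × ∃ λ f → C f × ∃ λ a → v ≈ᵛ (a ·ᵛ f)

  _⊥ : (Vect → Set (c ⊔ ℓ)) → Vect → Set (c ⊔ ℓ)
  (S ⊥) v = NonZeroV v × (∀ w → S w → dot v w ≈ 0#)

  frobVec : Carrier → Vect
  frobVec β i = pow β (q ℕ.^ toℕ i)

  Σpts : Vect → Set (c ⊔ ℓ)
  Σpts v = NonZeroV v × ∃ λ β → ¬ (β ≈ 0#) × ∃ λ a → v ≈ᵛ (a ·ᵛ frobVec β)

-- Evaluating a linearised polynomial g at β is the dot product of g with
-- (β, β^q, …, β^{q^{n-1}}). Hence a nonzero common root β of the maps in C
-- is exactly a point ⟨β, β^q, …⟩ of Σ orthogonal to every point of Ω(C).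
module Submission where

open import Defs
open import Level using (Level; _⊔_)
open import Data.Nat using (ℕ; zero; suc; _^_; _≤_; _≥_; NonZero)
open import Data.Nat.Properties using (m^n≢0)
open import Data.Nat.Primality using (prime⇒nonZero)
open import Data.Fin using (Fin; toℕ; fromℕ<)
open import Data.Fin.Properties using (toℕ-fromℕ<) renaming (_≟_ to _≟ᶠ_)
open import Data.Product using (∃; _×_; _,_)
open import Data.Empty using (⊥-elim)
open import Relation.Nullary using (¬_; yes; no)
open import Relation.Nullary.Decidable using (via-injection)
open import Relation.Binary.Definitions using (Decidable)
open import Relation.Binary.Bundles using (Setoid)
open import Relation.Binary.PropositionalEquality using (setoid)
open import Function.Bundles using (Bijection; _⇔_; mk⇔; Equivalence)
open import Function.Properties.Bijection using (Bijection⇒Inverse)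
open import Function.Properties.Inverse using (Inverse⇒Injection)
import Function.Construct.Symmetry as Symmetry
import Relation.Binary.Reasoning.Setoid as SetoidReasoning
import Algebra.Properties.CommutativeSemigroup as CommutativeSemigroupProperties

IsPrimePower⇒NonZero : ∀ {q} → IsPrimePower q → NonZero q
IsPrimePower⇒NonZero (p , e , p-prime , q≡p^e) rewrite q≡p^e =
  m^n≢0 p (suc e) {{prime⇒nonZero p-prime}}

≈-dec-fromFin : ∀ {c ℓ} {m} (S : Setoid c ℓ) →
                Bijection (setoid (Fin m)) S → Decidable (Setoid._≈_ S)
≈-dec-fromFin S bij =
  via-injection (Inverse⇒Injection (Symmetry.inverse (Bijection⇒Inverse bij))) _≟ᶠ_

module LinearisedPolynomials {c ℓ : Level} (F : Field c ℓ) (q n : ℕ) where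
  open Field F
  open FieldDefs F q n
  open SetoidReasoning (Field.setoid F)
  open CommutativeSemigroupProperties *-commutativeSemigroup using (x∙yz≈y∙xz)

  *-cancelˡ-≈0 : ∀ {a y} → ¬ (a ≈ 0#) → a * y ≈ 0# → y ≈ 0#
  *-cancelˡ-≈0 {a} {y} a≉0 ay≈0 with inverse a a≉0
  ... | a⁻¹ , aa⁻¹≈1 = begin
    y               ≈⟨ *-identityˡ y ⟨
    1# * y          ≈⟨ *-congʳ (trans (*-comm a⁻¹ a) aa⁻¹≈1) ⟨
    (a⁻¹ * a) * y   ≈⟨ *-assoc a⁻¹ a y ⟩
    a⁻¹ * (a * y)   ≈⟨ *-congˡ ay≈0 ⟩
    a⁻¹ * 0#        ≈⟨ zeroʳ a⁻¹ ⟩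
    0#              ∎

  pow-≈0 : ∀ {x} m .{{_ : NonZero m}} → x ≈ 0# → pow x m ≈ 0#
  pow-≈0 (suc m) x≈0 = trans (*-congʳ x≈0) (zeroˡ _)

  sumF-cong : ∀ m {f g : Fin m → Carrier} → (∀ i → f i ≈ g i) → sumF m f ≈ sumF m g
  sumF-cong zero    f≈g = refl
  sumF-cong (suc m) f≈g = +-cong (f≈g Fin.zero) (sumF-cong m (λ i → f≈g (Fin.suc i)))

  sumF-*ˡ : ∀ m a (f : Fin m → Carrier) → sumF m (λ i → a * f i) ≈ a * sumF m f
  sumF-*ˡ zero    a f = sym (zeroʳ a)
  sumF-*ˡ (suc m) a f = begin
    a * f Fin.zero + sumF m (λ i → a * f (Fin.suc i))
      ≈⟨ +-congˡ (sumF-*ˡ m a (λ i → f (Fin.suc i))) ⟩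
    a * f Fin.zero + a * sumF m (λ i → f (Fin.suc i))
      ≈⟨ distribˡ a _ _ ⟨
    a * sumF (suc m) f ∎

  sumF-zero : ∀ m {f : Fin m → Carrier} → (∀ i → f i ≈ 0#) → sumF m f ≈ 0#
  sumF-zero m {f} f≈0 = begin
    sumF m f                  ≈⟨ sumF-cong m (λ i → trans (f≈0 i) (sym (zeroˡ 0#))) ⟩
    sumF m (λ _ → 0# * 0#)    ≈⟨ sumF-*ˡ m 0# (λ _ → 0#) ⟩
    0# * sumF m (λ _ → 0#)    ≈⟨ zeroˡ _ ⟩
    0#                        ∎

  dot-congˡ : ∀ {u v} w → u ≈ᵛ v → dot u w ≈ dot v w
  dot-congˡ w u≈v = sumF-cong n (λ i → *-congʳ (u≈v i))

  dot-congʳ : ∀ u {v w} → v ≈ᵛ w → dot u v ≈ dot u w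
  dot-congʳ u v≈w = sumF-cong n (λ i → *-congˡ (v≈w i))

  dot-·ᵛˡ : ∀ a v w → dot (a ·ᵛ v) w ≈ a * dot v w
  dot-·ᵛˡ a v w = trans (sumF-cong n (λ i → *-assoc a (v i) (w i))) (sumF-*ˡ n a _)

  dot-·ᵛʳ : ∀ a v w → dot v (a ·ᵛ w) ≈ a * dot v w
  dot-·ᵛʳ a v w = trans (sumF-cong n (λ i → x∙yz≈y∙xz (v i) a (w i))) (sumF-*ˡ n a _)

  dot-frobVec : ∀ x g → dot (frobVec x) g ≈ eval g x
  dot-frobVec x g = sumF-cong n (λ i → *-comm (frobVec x i) (g i))

  eval-zeroᵛ : ∀ {g} x → (∀ i → g i ≈ 0#) → eval g x ≈ 0#
  eval-zeroᵛ x g≈0 = sumF-zero n (λ i → trans (*-congʳ (g≈0 i)) (zeroˡ _))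

  eval-≈0 : .{{NonZero q}} → ∀ g {x} → x ≈ 0# → eval g x ≈ 0#
  eval-≈0 g x≈0 = sumF-zero n (λ i →
    trans (*-congˡ (pow-≈0 (q ^ toℕ i) {{m^n≢0 q (toℕ i)}} x≈0)) (zeroʳ (g i)))

  frobVec-nonZero : 1 ≤ n → ∀ {x} → ¬ (x ≈ 0#) → NonZeroV (frobVec x)
  frobVec-nonZero n≥1 {x} x≉0 frobVec≈0 = x≉0 (trans (sym x≈entry₀) (frobVec≈0 i₀))
    where
    i₀ : Fin n
    i₀ = fromℕ< n≥1
    x≈entry₀ : frobVec x i₀ ≈ x
    x≈entry₀ rewrite toℕ-fromℕ< n≥1 = *-identityʳ x

  frobVec∈Σpts : 1 ≤ n → ∀ {x} → ¬ (x ≈ 0#) → Σpts (frobVec x)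
  frobVec∈Σpts n≥1 {x} x≉0 =
    frobVec-nonZero n≥1 x≉0 , x , x≉0 , 1# , (λ i → sym (*-identityˡ _))

  module _ (C : Vect → Set (c ⊔ ℓ)) where

    commonRoot⇒frobVec∈Ω⊥ : 1 ≤ n → ∀ {x} → ¬ (x ≈ 0#) →
                            (∀ g → C g → eval g x ≈ 0#) → (Ω C ⊥) (frobVec x)
    commonRoot⇒frobVec∈Ω⊥ n≥1 {x} x≉0 root = frobVec-nonZero n≥1 x≉0 , orthogonal
      where
      orthogonal : ∀ w → Ω C w → dot (frobVec x) w ≈ 0#
      orthogonal w (_ , g , g∈C , a , w≈ag) = begin
        dot (frobVec x) w         ≈⟨ dot-congʳ (frobVec x) w≈ag ⟩
        dot (frobVec x) (a ·ᵛ g)  ≈⟨ dot-·ᵛʳ a (frobVec x) g ⟩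
        a * dot (frobVec x) g     ≈⟨ *-congˡ (dot-frobVec x g) ⟩
        a * eval g x              ≈⟨ *-congˡ (root g g∈C) ⟩
        a * 0#                    ≈⟨ zeroʳ a ⟩
        0#                        ∎

    -- Ω C only contains the nonzero elements of C, so vanishing on the zero
    -- vectors of C has to be checked separately; this needs decidability.
    Ω⊥∩Σpts⇒commonRoot : Decidable _≈_ → ∀ {v} → (Ω C ⊥) v → Σpts v →
                         ∃ λ β → ¬ (β ≈ 0#) × (∀ g → C g → eval g β ≈ 0#)
    Ω⊥∩Σpts⇒commonRoot _≟_ {v} (v≢0 , v⊥ΩC) (_ , β , β≉0 , a , v≈aβ) = β , β≉0 , root
      where
      a≉0 : ¬ (a ≈ 0#)
      a≉0 a≈0 = v≢0 (λ i → trans (v≈aβ i) (trans (*-congʳ a≈0) (zeroˡ _)))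

      a*eval≈dot : ∀ g → a * eval g β ≈ dot v g
      a*eval≈dot g = begin
        a * eval g β              ≈⟨ *-congˡ (dot-frobVec β g) ⟨
        a * dot (frobVec β) g     ≈⟨ dot-·ᵛˡ a (frobVec β) g ⟨
        dot (a ·ᵛ frobVec β) g    ≈⟨ dot-congˡ g v≈aβ ⟨
        dot v g                   ∎

      root : ∀ g → C g → eval g β ≈ 0#
      root g g∈C with eval g β ≟ 0#
      ... | yes g[β]≈0 = g[β]≈0
      ... | no  g[β]≉0 = *-cancelˡ-≈0 a≉0 (trans (a*eval≈dot g) (v⊥ΩC g g∈ΩC))
        where
        g∈ΩC : Ω C g
        g∈ΩC = (λ g≈0 → g[β]≉0 (eval-zeroᵛ β g≈0)) ,
               g , g∈C , 1# , (λ i → sym (*-identityˡ (g i)))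

mainTheorem5 : ∀ {c ℓ : Level} (F : Field c ℓ) (q n : ℕ) →
    IsPrimePower q → n ≥ 1 →
    Bijection (setoid (Fin (q ^ n))) (Field.setoid F) →
    let open Field F
        open FieldDefs F q n
    in (k : ℕ) (b : Fin k → Vect) → LinIndep k b →
       ((∀ x → ((∀ g → Span k b g → eval g x ≈ 0#) ⇔ (x ≈ 0#)))
         ⇔ (¬ (∃ λ v → ((Ω (Span k b)) ⊥) v × Σpts v)))
mainTheorem5 F q n q-primePower n≥1 bij k b _ = mk⇔ noCommonPoint trivialKernel
  where
  open Field F
  open FieldDefs F q n
  open LinearisedPolynomials F q n
  instance
    q≢0 : NonZero q
    q≢0 = IsPrimePower⇒NonZero q-primePower

  _≟_ : Decidable _≈_
  _≟_ = ≈-dec-fromFin (Field.setoid F) bij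

  noCommonPoint : (∀ x → (∀ g → Span k b g → eval g x ≈ 0#) ⇔ (x ≈ 0#)) →
                  ¬ (∃ λ v → (Ω (Span k b) ⊥) v × Σpts v)
  noCommonPoint kernel (v , v∈Ω⊥ , v∈Σ)
    with Ω⊥∩Σpts⇒commonRoot (Span k b) _≟_ v∈Ω⊥ v∈Σ
  ... | β , β≉0 , root = β≉0 (Equivalence.to (kernel β) root)

  trivialKernel : ¬ (∃ λ v → (Ω (Span k b) ⊥) v × Σpts v) →
                  ∀ x → (∀ g → Span k b g → eval g x ≈ 0#) ⇔ (x ≈ 0#)
  trivialKernel noPoint x = mk⇔ rootIsZero (λ x≈0 g _ → eval-≈0 g x≈0)
    where
    rootIsZero : (∀ g → Span k b g → eval g x ≈ 0#) → x ≈ 0#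
    rootIsZero root with x ≟ 0#
    ... | yes x≈0 = x≈0
    ... | no  x≉0 = ⊥-elim (noPoint (frobVec x ,
          commonRoot⇒frobVec∈Ω⊥ (Span k b) n≥1 x≉0 root , frobVec∈Σpts n≥1 x≉0))
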